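{- Up to isomorphism, $M^*(K_{3,3})$ is the only matroid of the form $N/a$, where $N$ is a binary matroid and $a \in E(N)$ with $N\backslash a \cong M^*(K_{3,3})$, that is non-graphic and has no minor isomorphic to $F_7$ or $F_7^*$. That is, if $N$ is binary, $a\in E(N)$, $N\backslash a \cong M^*(K_{3,3})$, and $N/a$ is non-graphic with no $F_7$ or $F_7^*$ minor, then $N/a \cong M^*(K_{3,3})$.
   Context: $F_7$ is the Fano matroid, $F_7^*$ its dual, and $M^*(K_{3,3})$ is the dual of the cycle matroid of $K_{3,3}$. A matroid $N/a$ with $N\backslash a\cong F$ is called an elementary quotient of $F$. -}

module Defs where

open import Data.Nat using (ℕ; suc; _<_)
open import Data.Bool using (Bool; true; false; _xor_; if_then_else_)
open import Data.Fin using (Fin; zero; suc; #_; _≟_)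
open import Data.Fin.Subset using (Subset; ⊥; ⁅_⁆; _∈_; _∉_; _⊆_; _∪_; ∣_∣; Nonempty)
open import Data.Vec using (Vec; []; _∷_; lookup; tabulate; insertAt; foldr; zipWith)
open import Data.Product using (Σ; ∃; _×_; _,_; proj₁; proj₂)
open import Data.Sum using (_⊎_)
open import Relation.Nullary using (¬_; does)
open import Relation.Binary.PropositionalEquality using (_≡_)
open import Function.Bundles using (_↔_; _⇔_; Inverse)

-- Set systems on the ground set Fin n, given by their independent sets.

SetSys : ℕ → Set₁
SetSys n = Subset n → Set

record IsMatroid {n : ℕ} (I : SetSys n) : Set where
  field
    empty-indep : I ⊥
    hereditary  : ∀ X Y → Y ⊆ X → I X → I Y
    augment     : ∀ X Y → I X → I Y → ∣ X ∣ < ∣ Y ∣ →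
                  ∃ λ e → e ∈ Y × e ∉ X × I (X ∪ ⁅ e ⁆)

Basis : ∀ {n} → SetSys n → Subset n → Set
Basis I B = I B × (∀ C → B ⊆ C → I C → C ⊆ B)

Dual : ∀ {n} → SetSys n → SetSys n
Dual I X = ∃ λ B → Basis I B × (∀ e → e ∈ X → e ∉ B)

image : ∀ {m k} → Fin m ↔ Fin k → Subset m → Subset k
image σ X = tabulate (λ j → lookup X (Inverse.from σ j))

Iso : ∀ {m k} → SetSys m → SetSys k → Set
Iso {m} {k} I J = Σ (Fin m ↔ Fin k) λ σ → ∀ X → I X ⇔ J (image σ X)

-- Single-element deletion and contraction.  The ground set of N\a and
-- N/a is Fin m, identified with Fin (suc m) minus a via insertAt.

Del : ∀ {m} → SetSys (suc m) → Fin (suc m) → SetSys m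
Del I a X = I (insertAt X a false)

Con : ∀ {m} → SetSys (suc m) → Fin (suc m) → SetSys m
Con I a X = (I ⁅ a ⁆ × I (insertAt X a true))
          ⊎ (¬ I ⁅ a ⁆ × I (insertAt X a false))

data HasMinor {k : ℕ} (J : SetSys k) : ∀ {m} → SetSys m → Set₁ where
  iso : ∀ {m} {I : SetSys m} → Iso I J → HasMinor J I
  del : ∀ {m} {I : SetSys (suc m)} (a : Fin (suc m)) →
        HasMinor J (Del I a) → HasMinor J I
  con : ∀ {m} {I : SetSys (suc m)} (a : Fin (suc m)) →
        HasMinor J (Con I a) → HasMinor J I

-- Binary matroids: vector matroids of matrices over GF(2) = (Bool, xor).

Matrix₂ : ℕ → ℕ → Set
Matrix₂ r n = Fin r → Fin n → Bool

colSum : ∀ {r n} → Matrix₂ r n → Subset n → Fin r → Bool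
colSum A Y i = foldr _ _xor_ false
                 (zipWith (λ y v → if y then v else false) Y (tabulate (A i)))

LinIndep : ∀ {r n} → Matrix₂ r n → SetSys n
LinIndep A X = ∀ Y → Y ⊆ X → Nonempty Y → ¬ (∀ i → colSum A Y i ≡ false)

Binary : ∀ {n} → SetSys n → Set
Binary {n} I = Σ ℕ λ r → Σ (Matrix₂ r n) λ A → ∀ X → I X ⇔ LinIndep A X

-- Graphs (loops and parallel edges allowed) with edge set Fin n, and their
-- cycle matroids.  M(G) is the vector matroid over GF(2) of the
-- vertex–edge incidence matrix (column of e = u–v is e_u + e_v; a loop
-- gives the zero column); equivalently, X is independent iff it contains
-- no nonempty edge set in which every vertex has even degree, i.e. no cycle.

record Graph (n : ℕ) : Set where
  field
    nV   : ℕ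
    ends : Fin n → Fin nV × Fin nV

incidence : ∀ {n} (G : Graph n) → Matrix₂ (Graph.nV G) n
incidence G v e = does (v ≟ proj₁ (Graph.ends G e)) xor does (v ≟ proj₂ (Graph.ends G e))

CycleMatroid : ∀ {n} → Graph n → SetSys n
CycleMatroid G = LinIndep (incidence G)

Graphic : ∀ {n} → SetSys n → Set
Graphic {n} I = Σ (Graph n) λ G → ∀ X → I X ⇔ CycleMatroid G X

-- K_{3,3}: vertices 0,1,2 | 3,4,5 ; edges i–(3+j), edge number 3i+j.
K33 : Graph 9
K33 = record { nV = 6 ; ends = λ e → lookup edges e }
  where
  edges : Vec (Fin 6 × Fin 6) 9
  edges = (# 0 , # 3) ∷ (# 0 , # 4) ∷ (# 0 , # 5)
        ∷ (# 1 , # 3) ∷ (# 1 , # 4) ∷ (# 1 , # 5)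
        ∷ (# 2 , # 3) ∷ (# 2 , # 4) ∷ (# 2 , # 5) ∷ []

MK33dual : SetSys 9
MK33dual = Dual (CycleMatroid K33)

-- Fano matroid F7 = PG(2,2): columns are the 7 nonzero vectors of GF(2)^3.
fanoMatrix : Matrix₂ 3 7
fanoMatrix i e = lookup (lookup cols e) i
  where
  cols : Vec (Vec Bool 3) 7
  cols = (true ∷ false ∷ false ∷ []) ∷ (false ∷ true ∷ false ∷ [])
       ∷ (false ∷ false ∷ true ∷ []) ∷ (true ∷ true ∷ false ∷ [])
       ∷ (true ∷ false ∷ true ∷ []) ∷ (false ∷ true ∷ true ∷ [])
       ∷ (true ∷ true ∷ true ∷ []) ∷ []

F7 : SetSys 7
F7 = LinIndep fanoMatrix

F7dual : SetSys 7
F7dual = Dual F7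

{-# OPTIONS --safe #-}
-- Let A represent N over GF(2).  The columns of A other than a have a column basis L of
-- size 4 (from a basis of M*(K₃,₃) ≅ N\a), so they factor as L K′ with L injective.  If
-- column a is outside the span of L, then a is a coloop and N/a = N\a; if it is zero, a is
-- a loop and again N/a = N\a.  Otherwise column a = L c with c ≠ 0, so N is represented by
-- the 4-row matrix [K′ | c], and pivoting on a nonzero entry of c represents N/a by a 3-row
-- matrix U.  A binary matroid of rank at most 3 either contains all seven points of PG(2,2)
-- (an F₇-restriction) or misses one; in the latter case a shear moves the missing point to
-- (1,1,1) and the remaining six points are the edges of K₄, so N/a is graphic.
module Submission where

open import Defs
open import Algebra.Bundles using (CommutativeRing)
open import Data.Bool using (Bool; true; false; _∧_; _xor_)
import Data.Bool as Bool
open import Data.Bool.Properties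
  using (xor-∧-commutativeRing; ∧-comm; ∧-assoc; ∧-zeroʳ; ∧-identityʳ; xor-identityʳ; xor-same; xor-comm; xor-assoc;
         ∧-conicalˡ; ∧-conicalʳ; ¬-not)
open import Data.Empty using (⊥-elim)
open import Data.Fin using (Fin; zero; suc; punchIn; punchOut; _≟_; #_)
open import Data.Fin.Properties using (punchInᵢ≢i; punchIn-punchOut; any?; all?; ¬∀⟶∃¬)
open import Data.Fin.Subset using (Subset; _∈_; _∉_; _⊆_; _∪_; ⁅_⁆; ∁)
open import Data.Fin.Subset.Properties
  using (anySubset?; _∈?_; x∈p∪q⁺; x∈p∪q⁻; p⊆p∪q; x∈⁅x⁆; x∈⁅y⁆⇒x≡y; x∈∁p⇒x∉p; x∉p⇒x∈∁p)
open import Data.Nat using (ℕ; zero; suc)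
open import Data.Product using (Σ; ∃; _×_; _,_; proj₁; proj₂)
import Data.Product as Product
open import Data.Sum using (_⊎_; inj₁; inj₂; [_,_]′)
open import Data.Vec using (_∷_; []; lookup; tabulate)
import Data.Vec as Vec
import Data.Vec.Properties as Vec
open import Data.Vec.Functional using (Vector; removeAt; insertAt)
open import Data.Vec.Functional.Properties using (insertAt-lookup; insertAt-punchIn; removeAt-insertAt)
open import Data.Vec.Properties
  using (lookup∘tabulate; tabulate∘lookup; tabulate-cong; []=⇒lookup; lookup⇒[]=; lookup-replicate)
open import Function using (_∘_; const; id)
open import Function.Bundles using (_⇔_; mk⇔; mk↔ₛ′; Equivalence; Inverse; _↔_)
open import Function.Definitions using (Injective)
open import Function.Properties.Equivalence using () renaming (trans to ⇔-trans; sym to ⇔-sym)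
open import Relation.Binary.PropositionalEquality
open import Relation.Nullary using (¬_; Dec; does; yes; no; contradiction)
open import Relation.Nullary.Decidable
  using (map′; _×-dec_; _→-dec_; ¬?; decidable-stable; from-yes; from-no)

open CommutativeRing xor-∧-commutativeRing using (semiring)
open import Algebra.Properties.Semiring.Sum semiring
  using (sum; sum-syntax; sum-cong-≗; sum-replicate-zero; sum-remove; ∑-distrib-+; ∑-comm;
         *-distribˡ-sum; *-distribʳ-sum)

private
  variable
    k m n r s : ℕ

¬-⇔ : {P Q : Set} → P ⇔ Q → (¬ P) ⇔ (¬ Q)
¬-⇔ P⇔Q = mk⇔ (λ ¬p → ¬p ∘ Equivalence.from P⇔Q) (λ ¬q → ¬q ∘ Equivalence.to P⇔Q)

xor≡false⇒≡ : ∀ u v → u xor v ≡ false → u ≡ v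
xor≡false⇒≡ true  true  _ = refl
xor≡false⇒≡ false false _ = refl

∀-punchIn : {P : Fin (suc n) → Set} (a : Fin (suc n)) → P a → (∀ e → P (punchIn a e)) → ∀ e → P e
∀-punchIn {P = P} a Pa P∘punchIn e with a ≟ e
... | yes refl = Pa
... | no a≢e   = subst P (punchIn-punchOut a≢e) (P∘punchIn (punchOut a≢e))

tabulate-injective : {A : Set} {f g : Fin n → A} → tabulate f ≡ tabulate g → f ≗ g
tabulate-injective {f = f} {g} f≡g i =
  trans (sym (lookup∘tabulate f i)) (trans (cong (λ v → lookup v i) f≡g) (lookup∘tabulate g i))

δ : Fin n → Vector Bool n
δ p e = does (p ≟ e)

δ-refl : (p : Fin n) → δ p p ≡ true
δ-refl p with p ≟ p
... | yes _    = refl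
... | no p≢p   = ⊥-elim (p≢p refl)

δ-≢ : {p e : Fin n} → p ≢ e → δ p e ≡ false
δ-≢ {p = p} {e} p≢e with p ≟ e
... | yes p≡e = ⊥-elim (p≢e p≡e)
... | no _    = refl

δ≡true⇒≡ : {p e : Fin n} → δ p e ≡ true → p ≡ e
δ≡true⇒≡ {p = p} {e} _ with p ≟ e
... | yes p≡e = p≡e

δ-injective : {b : Fin k → Fin n} → Injective _≡_ _≡_ b → ∀ j j′ → δ (b j′) (b j) ≡ δ j j′
δ-injective {b = b} b-inj j j′ with j ≟ j′
... | yes refl = δ-refl (b j)
... | no j≢j′  = δ-≢ (λ bj′≡bj → j≢j′ (sym (b-inj bj′≡bj)))

Nonzero : Vector Bool n → Set
Nonzero v = ∃ λ e → v e ≡ true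

nonzero? : (v : Vector Bool n) → Dec (Nonzero v)
nonzero? v = any? (λ e → v e Bool.≟ true)

sum-zero : (f : Vector Bool n) → (∀ e → f e ≡ false) → sum f ≡ false
sum-zero {n} f f≡0 = trans (sum-cong-≗ f≡0) (sum-replicate-zero n)

sum-nonzero : (f : Vector Bool n) → sum f ≡ true → Nonzero f
sum-nonzero {suc n} f ∑f≡1 with f zero in f₀
... | true  = zero , f₀
... | false = Product.map suc id (sum-nonzero (f ∘ suc) ∑f≡1)

sum-δ : (v : Vector Bool n) (p : Fin n) → ∑[ e < n ] (v e ∧ δ p e) ≡ v p
sum-δ {suc n} v p = begin
  ∑[ e < suc n ] (v e ∧ δ p e)                   ≡⟨ sum-remove {i = p} (λ e → v e ∧ δ p e) ⟩
  (v p ∧ δ p p) xor ∑[ e < n ] (v (punchIn p e) ∧ δ p (punchIn p e))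
                                                 ≡⟨ cong₂ _xor_ (cong (v p ∧_) (δ-refl p)) (sum-zero _ off-p) ⟩
  (v p ∧ true) xor false                         ≡⟨ xor-identityʳ _ ⟩
  v p ∧ true                                     ≡⟨ ∧-identityʳ (v p) ⟩
  v p                                            ∎
  where
  open ≡-Reasoning
  off-p : ∀ e → v (punchIn p e) ∧ δ p (punchIn p e) ≡ false
  off-p e = trans (cong (v (punchIn p e) ∧_) (δ-≢ (punchInᵢ≢i p e ∘ sym))) (∧-zeroʳ _)

∑-linear : (y f g : Vector Bool n) (c : Bool) →
           ∑[ e < n ] (y e ∧ (f e xor (c ∧ g e))) ≡ ∑[ e < n ] (y e ∧ f e) xor (c ∧ ∑[ e < n ] (y e ∧ g e))
∑-linear {n = n} y f g c = begin
  ∑[ e < n ] (y e ∧ (f e xor (c ∧ g e)))                    ≡⟨ sum-cong-≗ (λ e → distrib (y e) (f e) (g e)) ⟩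
  ∑[ e < n ] ((y e ∧ f e) xor (c ∧ (y e ∧ g e)))
    ≡⟨ ∑-distrib-+ (λ e → y e ∧ f e) (λ e → c ∧ (y e ∧ g e)) ⟩
  ∑[ e < n ] (y e ∧ f e) xor ∑[ e < n ] (c ∧ (y e ∧ g e))   ≡⟨ cong (sum (λ e → y e ∧ f e) xor_)
                                                                    (sym (*-distribˡ-sum c (λ e → y e ∧ g e))) ⟩
  ∑[ e < n ] (y e ∧ f e) xor (c ∧ ∑[ e < n ] (y e ∧ g e))   ∎
  where
  open ≡-Reasoning
  distrib : ∀ u v w → u ∧ (v xor (c ∧ w)) ≡ (u ∧ v) xor (c ∧ (u ∧ w))
  distrib true  v w = refl
  distrib false v w = sym (∧-zeroʳ c)

column : Matrix₂ r n → Fin n → Vector Bool r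
column A e i = A i e

_·_ : Matrix₂ r n → Vector Bool n → Vector Bool r
_·_ {n = n} A y i = ∑[ e < n ] (y e ∧ A i e)

_⋆_ : Matrix₂ r s → Matrix₂ s n → Matrix₂ r n
(L ⋆ K) i e = (L · column K e) i

deleteColumn : Matrix₂ r (suc n) → Fin (suc n) → Matrix₂ r n
deleteColumn A a i = removeAt (A i) a

restrict : Matrix₂ r n → (Fin k → Fin n) → Matrix₂ r k
restrict A b i j = A i (b j)

TrivialKernel : Matrix₂ r k → Set
TrivialKernel L = ∀ c → L · c ≗ const false → c ≗ const false

InSpan : Matrix₂ r k → Vector Bool r → Set
InSpan L v = ∃ λ c → v ≗ L · c

·-cong : (A : Matrix₂ r n) {y y′ : Vector Bool n} → y ≗ y′ → A · y ≗ A · y′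
·-cong A y≡y′ i = sum-cong-≗ (λ e → cong (_∧ A i e) (y≡y′ e))

inSpan? : (L : Matrix₂ r k) (v : Vector Bool r) → Dec (InSpan L v)
inSpan? L v = map′ (Product.map lookup id)
  (λ (c , v≡Lc) → tabulate c , λ i → trans (v≡Lc i) (·-cong L (sym ∘ lookup∘tabulate c) i))
  (anySubset? λ C → all? λ i → v i Bool.≟ (L · lookup C) i)

·-congˡ : {A B : Matrix₂ r n} → (∀ i e → A i e ≡ B i e) → ∀ y → A · y ≗ B · y
·-congˡ A≡B y i = sum-cong-≗ (λ e → cong (y e ∧_) (A≡B i e))

·-zero : (A : Matrix₂ r n) → A · const false ≗ const false
·-zero A i = sum-zero (λ e → false ∧ A i e) (λ _ → refl)

·-δ : (A : Matrix₂ r n) (p : Fin n) → A · δ p ≗ column A p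
·-δ A p i = trans (sum-cong-≗ (λ e → ∧-comm (δ p e) (A i e))) (sum-δ (A i) p)

·-split : (A : Matrix₂ r (suc n)) (a : Fin (suc n)) (y : Vector Bool (suc n)) →
          ∀ i → (A · y) i ≡ (y a ∧ A i a) xor (deleteColumn A a · removeAt y a) i
·-split A a y i = sum-remove {i = a} (λ e → y e ∧ A i e)

·-insertAt : (A : Matrix₂ r (suc n)) (a : Fin (suc n)) (y : Vector Bool n) (v : Bool) →
             ∀ i → (A · insertAt y a v) i ≡ (v ∧ A i a) xor (deleteColumn A a · y) i
·-insertAt A a y v i = trans (·-split A a (insertAt y a v) i)
  (cong₂ _xor_ (cong (_∧ A i a) (insertAt-lookup y a v))
               (·-cong (deleteColumn A a) (removeAt-insertAt y a v) i))

·-factor : {A : Matrix₂ r n} (L : Matrix₂ r s) (K : Matrix₂ s n) →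
           (∀ i e → A i e ≡ (L ⋆ K) i e) → ∀ y → A · y ≗ L · (K · y)
·-factor {n = n} {s = s} {A = A} L K A≡L⋆K y i = begin
  ∑[ e < n ] (y e ∧ A i e)                       ≡⟨ sum-cong-≗ (λ e → cong (y e ∧_) (A≡L⋆K i e)) ⟩
  ∑[ e < n ] (y e ∧ ∑[ j < s ] (K j e ∧ L i j))  ≡⟨ sum-cong-≗ (λ e → *-distribˡ-sum (y e) (λ j → K j e ∧ L i j)) ⟩
  ∑[ e < n ] ∑[ j < s ] (y e ∧ (K j e ∧ L i j))  ≡⟨ ∑-comm (λ e j → y e ∧ (K j e ∧ L i j)) ⟩
  ∑[ j < s ] ∑[ e < n ] (y e ∧ (K j e ∧ L i j))
    ≡⟨ sum-cong-≗ (λ j → sum-cong-≗ (λ e → sym (∧-assoc (y e) (K j e) (L i j)))) ⟩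
  ∑[ j < s ] ∑[ e < n ] ((y e ∧ K j e) ∧ L i j)  ≡⟨ sum-cong-≗ (λ j → sym (*-distribʳ-sum (L i j) (λ e → y e ∧ K j e))) ⟩
  ∑[ j < s ] ((K · y) j ∧ L i j)                 ∎
  where open ≡-Reasoning

push : (Fin k → Fin n) → Vector Bool k → Vector Bool n
push {k = k} b c e = ∑[ j < k ] (c j ∧ δ (b j) e)

·-push : (A : Matrix₂ r n) (b : Fin k → Fin n) (c : Vector Bool k) → A · push b c ≗ restrict A b · c
·-push {n = n} {k = k} A b c i = begin
  ∑[ e < n ] (∑[ j < k ] (c j ∧ δ (b j) e) ∧ A i e)  ≡⟨ sum-cong-≗ (λ e → *-distribʳ-sum (A i e) (λ j → c j ∧ δ (b j) e)) ⟩
  ∑[ e < n ] ∑[ j < k ] ((c j ∧ δ (b j) e) ∧ A i e)  ≡⟨ ∑-comm (λ e j → (c j ∧ δ (b j) e) ∧ A i e) ⟩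
  ∑[ j < k ] ∑[ e < n ] ((c j ∧ δ (b j) e) ∧ A i e)
    ≡⟨ sum-cong-≗ (λ j → sum-cong-≗ (λ e → ∧-assoc (c j) (δ (b j) e) (A i e))) ⟩
  ∑[ j < k ] ∑[ e < n ] (c j ∧ (δ (b j) e ∧ A i e))
    ≡⟨ sum-cong-≗ (λ j → sym (*-distribˡ-sum (c j) (λ e → δ (b j) e ∧ A i e))) ⟩
  ∑[ j < k ] (c j ∧ (A · δ (b j)) i)                 ≡⟨ sum-cong-≗ (λ j → cong (c j ∧_) (·-δ A (b j) i)) ⟩
  ∑[ j < k ] (c j ∧ A i (b j))                       ∎
  where open ≡-Reasoning

module _ {b : Fin k → Fin n} (b-inj : Injective _≡_ _≡_ b) where

  push-at : ∀ c j → push b c (b j) ≡ c j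
  push-at c j = trans (sum-cong-≗ (λ j′ → cong (c j′ ∧_) (δ-injective b-inj j j′))) (sum-δ c j)

  push-support : ∀ c e → push b c e ≡ true → ∃ λ j → b j ≡ e
  push-support c e pushₑ≡1 =
    Product.map id (δ≡true⇒≡ ∘ ∧-conicalʳ _ _) (sum-nonzero (λ j → c j ∧ δ (b j) e) pushₑ≡1)

  push-pull : ∀ y → (∀ e → y e ≡ true → ∃ λ j → b j ≡ e) → y ≗ push b (y ∘ b)
  push-pull y supp e with any? (λ j → b j ≟ e)
  ... | yes (j , refl) = sym (push-at (y ∘ b) j)
  ... | no e∉b = trans (¬-not (e∉b ∘ supp e)) (sym (¬-not (e∉b ∘ push-support (y ∘ b) e)))

-- Independence of columns

_⊑_ : Vector Bool n → Vector Bool n → Set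
y ⊑ x = ∀ e → y e ≡ true → x e ≡ true

Dependency : Matrix₂ r n → Vector Bool n → Vector Bool n → Set
Dependency A x y = y ⊑ x × Nonzero y × A · y ≗ const false

Dependent : Matrix₂ r n → Vector Bool n → Set
Dependent A x = ∃ (Dependency A x)

Independent : Matrix₂ r n → Vector Bool n → Set
Independent A x = ¬ Dependent A x

Dependency-resp-≗ : (A : Matrix₂ r n) {x y y′ : Vector Bool n} →
                    y ≗ y′ → Dependency A x y → Dependency A x y′
Dependency-resp-≗ A y≡y′ (y⊑x , (e , yₑ≡1) , Ay≡0) =
  (λ d y′d≡1 → y⊑x d (trans (y≡y′ d) y′d≡1)) ,
  (e , trans (sym (y≡y′ e)) yₑ≡1) ,
  (λ i → trans (sym (·-cong A y≡y′ i)) (Ay≡0 i))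

Dependent-mono : (A : Matrix₂ r n) {x x′ : Vector Bool n} → x ⊑ x′ → Dependent A x → Dependent A x′
Dependent-mono A x⊑x′ (y , y⊑x , rest) = y , (λ e → x⊑x′ e ∘ y⊑x e) , rest

Independent-resp-≗ : (A : Matrix₂ r n) {x x′ : Vector Bool n} → x ≗ x′ → Independent A x ⇔ Independent A x′
Independent-resp-≗ A x≡x′ = mk⇔
  (λ indep → indep ∘ Dependent-mono A (λ e → trans (x≡x′ e)))
  (λ indep → indep ∘ Dependent-mono A (λ e → trans (sym (x≡x′ e))))

dependent? : (A : Matrix₂ r n) (x : Vector Bool n) → Dec (Dependent A x)
dependent? A x = map′ (Product.map lookup id)
  (λ (y , dep) → tabulate y , Dependency-resp-≗ A (sym ∘ lookup∘tabulate y) dep)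
  (anySubset? λ Y → all? (λ e → (lookup Y e Bool.≟ true) →-dec (x e Bool.≟ true))
               ×-dec nonzero? (lookup Y)
               ×-dec all? (λ i → (A · lookup Y) i Bool.≟ false))

Dependent-of-¬Independent : (A : Matrix₂ r n) {x : Vector Bool n} → ¬ Independent A x → Dependent A x
Dependent-of-¬Independent A {x} = decidable-stable (dependent? A x)

colSum≡· : (A : Matrix₂ r n) (Y : Subset n) → ∀ i → colSum A Y i ≡ (A · lookup Y) i
colSum≡· A []          i = refl
colSum≡· A (true ∷ Y)  i = cong (A i zero xor_) (colSum≡· (λ i → A i ∘ suc) Y i)
colSum≡· A (false ∷ Y) i = colSum≡· (λ i → A i ∘ suc) Y i

LinIndep⇔Independent : (A : Matrix₂ r n) (X : Subset n) → LinIndep A X ⇔ Independent A (lookup X)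
LinIndep⇔Independent A X = mk⇔
  (λ indep (y , y⊑X , (e , yₑ≡1) , Ay≡0) →
     indep (tabulate y)
       (λ {d} d∈y → lookup⇒[]= d X (y⊑X d (trans (sym (lookup∘tabulate y d)) ([]=⇒lookup d∈y))))
       (e , lookup⇒[]= e (tabulate y) (trans (lookup∘tabulate y e) yₑ≡1))
       (λ i → trans (colSum≡· A (tabulate y) i) (trans (·-cong A (lookup∘tabulate y) i) (Ay≡0 i))))
  (λ indep Y Y⊆X (e , e∈Y) ΣY≡0 →
     indep (lookup Y , (λ d Y_d≡1 → []=⇒lookup (Y⊆X (lookup⇒[]= d Y Y_d≡1))) , (e , []=⇒lookup e∈Y) ,
            (λ i → trans (sym (colSum≡· A Y i)) (ΣY≡0 i))))

lookup-insertAt : (X : Subset n) (a : Fin (suc n)) (v : Bool) →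
                  lookup (Vec.insertAt X a v) ≗ insertAt (lookup X) a v
lookup-insertAt X a v = ∀-punchIn a
  (trans (Vec.insertAt-lookup X a v) (sym (insertAt-lookup (lookup X) a v)))
  (λ e → trans (Vec.insertAt-punchIn X a v e) (sym (insertAt-punchIn (lookup X) a v e)))

LinIndep-insertAt : (A : Matrix₂ r (suc n)) (X : Subset n) (a : Fin (suc n)) (v : Bool) →
                    LinIndep A (Vec.insertAt X a v) ⇔ Independent A (insertAt (lookup X) a v)
LinIndep-insertAt A X a v =
  ⇔-trans (LinIndep⇔Independent A (Vec.insertAt X a v)) (Independent-resp-≗ A (lookup-insertAt X a v))

lookup-⁅⁆ : (a : Fin n) → lookup ⁅ a ⁆ ≗ δ a
lookup-⁅⁆ zero    zero    = refl
lookup-⁅⁆ zero    (suc e) = lookup-replicate e false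
lookup-⁅⁆ (suc a) zero    = refl
lookup-⁅⁆ (suc a) (suc e) = lookup-⁅⁆ a e

Dependent-δ⇔ : (A : Matrix₂ r n) (a : Fin n) → Dependent A (δ a) ⇔ column A a ≗ const false
Dependent-δ⇔ {n = suc n} A a = mk⇔
  (λ (y , y⊑δ , (e , yₑ≡1) , Ay≡0) →
     let yₐ≡1 = subst (λ e → y e ≡ true) (sym (δ≡true⇒≡ (y⊑δ e yₑ≡1))) yₑ≡1
         y′≡0 : removeAt y a ≗ const false
         y′≡0 d = ¬-not λ y′d≡1 → punchInᵢ≢i a d (sym (δ≡true⇒≡ (y⊑δ (punchIn a d) y′d≡1)))
     in λ i → begin
       A i a                                                  ≡⟨ sym (xor-identityʳ (A i a)) ⟩
       A i a xor false                                        ≡⟨ cong₂ (λ u v → (u ∧ A i a) xor v) (sym yₐ≡1)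
                                                                       (sym (trans (·-cong A′ y′≡0 i) (·-zero A′ i))) ⟩
       (y a ∧ A i a) xor (A′ · removeAt y a) i                ≡⟨ sym (·-split A a y i) ⟩
       (A · y) i                                              ≡⟨ Ay≡0 i ⟩
       false                                                  ∎)
  (λ colₐ≡0 → δ a , (λ _ → id) , (a , δ-refl a) , λ i → trans (·-δ A a i) (colₐ≡0 i))
  where
  open ≡-Reasoning
  A′ = deleteColumn A a

LinIndep-⁅⁆⇔nonzero : (A : Matrix₂ r n) (a : Fin n) → LinIndep A ⁅ a ⁆ ⇔ (¬ column A a ≗ const false)
LinIndep-⁅⁆⇔nonzero A a = ⇔-trans (LinIndep⇔Independent A ⁅ a ⁆)
  (⇔-trans (Independent-resp-≗ A (lookup-⁅⁆ a)) (¬-⇔ (Dependent-δ⇔ A a)))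

-- Independence under row and column operations

Independent-factor : {A : Matrix₂ r n} (L : Matrix₂ r s) (K : Matrix₂ s n) →
                     (∀ i e → A i e ≡ (L ⋆ K) i e) → TrivialKernel L →
                     ∀ x → Independent A x ⇔ Independent K x
Independent-factor L K A≡L⋆K ker-L x = ¬-⇔ (mk⇔
  (λ (y , y⊑x , y≢0 , Ay≡0) →
     y , y⊑x , y≢0 , ker-L (K · y) (λ i → trans (sym (·-factor L K A≡L⋆K y i)) (Ay≡0 i)))
  (λ (y , y⊑x , y≢0 , Ky≡0) →
     y , y⊑x , y≢0 , λ i → trans (·-factor L K A≡L⋆K y i) (trans (·-cong L Ky≡0 i) (·-zero L i))))

insertAt-⊑ : {y x : Vector Bool n} (a : Fin (suc n)) {v w : Bool} →
             (v ≡ true → w ≡ true) → y ⊑ x → insertAt y a v ⊑ insertAt x a w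
insertAt-⊑ {y = y} {x} a {v} {w} v⇒w y⊑x = ∀-punchIn a
  (λ yₐ≡1 → trans (insertAt-lookup x a w) (v⇒w (trans (sym (insertAt-lookup y a v)) yₐ≡1)))
  (λ e yₑ≡1 → trans (insertAt-punchIn x a w e) (y⊑x e (trans (sym (insertAt-punchIn y a v e)) yₑ≡1)))

removeAt-⊑ : {y : Vector Bool (suc n)} {x : Vector Bool n} (a : Fin (suc n)) {v : Bool} →
             y ⊑ insertAt x a v → removeAt y a ⊑ x
removeAt-⊑ {x = x} a {v} y⊑x e yₑ≡1 = trans (sym (insertAt-punchIn x a v e)) (y⊑x (punchIn a e) yₑ≡1)

⊑-insertAt-false : {y : Vector Bool (suc n)} {x : Vector Bool n} (a : Fin (suc n)) →
                   y ⊑ insertAt x a false → y a ≡ false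
⊑-insertAt-false {y = y} {x} a y⊑x with y a in yₐ
... | false = refl
... | true  = trans (sym (y⊑x a yₐ)) (insertAt-lookup x a false)

Nonzero-insertAt : {y : Vector Bool n} (a : Fin (suc n)) (v : Bool) → Nonzero y → Nonzero (insertAt y a v)
Nonzero-insertAt {y = y} a v (e , yₑ≡1) = punchIn a e , trans (insertAt-punchIn y a v e) yₑ≡1

Nonzero-removeAt : {y : Vector Bool (suc n)} (a : Fin (suc n)) → y a ≡ false → Nonzero y → Nonzero (removeAt y a)
Nonzero-removeAt {y = y} a yₐ≡0 (e , yₑ≡1) with a ≟ e
... | yes refl = contradiction (trans (sym yₐ≡0) yₑ≡1) λ ()
... | no a≢e   = punchOut a≢e , trans (cong y (punchIn-punchOut a≢e)) yₑ≡1

Dependent-removeAt : (A : Matrix₂ r (suc n)) (a : Fin (suc n)) {x : Vector Bool n} {y : Vector Bool (suc n)} {v : Bool} →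
                     y ⊑ insertAt x a v → y a ≡ false → Nonzero y × A · y ≗ const false →
                     Dependent (deleteColumn A a) x
Dependent-removeAt A a {y = y} y⊑x yₐ≡0 (y≢0 , Ay≡0) =
  removeAt y a , removeAt-⊑ a y⊑x , Nonzero-removeAt a yₐ≡0 y≢0 ,
  λ i → trans (cong (λ u → (u ∧ A i a) xor (deleteColumn A a · removeAt y a) i) (sym yₐ≡0))
              (trans (sym (·-split A a y i)) (Ay≡0 i))

Dependent-delete : (A : Matrix₂ r (suc n)) (a : Fin (suc n)) (x : Vector Bool n) →
                   Dependent A (insertAt x a false) ⇔ Dependent (deleteColumn A a) x
Dependent-delete A a x = mk⇔
  (λ (y , y⊑x , rest) → Dependent-removeAt A a y⊑x (⊑-insertAt-false a y⊑x) rest)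
  (λ (y , y⊑x , y≢0 , A′y≡0) →
     insertAt y a false , insertAt-⊑ a id y⊑x , Nonzero-insertAt a false y≢0 ,
     λ i → trans (·-insertAt A a y false i) (A′y≡0 i))

Del-LinIndep : (A : Matrix₂ r (suc n)) (a : Fin (suc n)) (X : Subset n) →
               Del (LinIndep A) a X ⇔ LinIndep (deleteColumn A a) X
Del-LinIndep A a X = ⇔-trans (LinIndep-insertAt A X a false)
  (⇔-trans (¬-⇔ (Dependent-delete A a (lookup X))) (⇔-sym (LinIndep⇔Independent (deleteColumn A a) X)))

-- Clear column a with row j₀ (adding K i a times row j₀ to each row i), then drop row j₀ and column a.
pivot : Matrix₂ (suc s) (suc n) → Fin (suc n) → Fin (suc s) → Matrix₂ s n
pivot K a j₀ i e = K (punchIn j₀ i) (punchIn a e) xor (K (punchIn j₀ i) a ∧ K j₀ (punchIn a e))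

module _ (K : Matrix₂ (suc s) (suc n)) (a : Fin (suc n)) (j₀ : Fin (suc s)) (Kⱼ₀ₐ≡1 : K j₀ a ≡ true) where

  private
    K′ = deleteColumn K a
    U  = pivot K a j₀

    U· : ∀ y i → (U · y) i ≡ (K′ · y) (punchIn j₀ i) xor (K (punchIn j₀ i) a ∧ (K′ · y) j₀)
    U· y i = ∑-linear y (K′ (punchIn j₀ i)) (K′ j₀) (K (punchIn j₀ i) a)

    toPivot : ∀ x → Dependent K (insertAt x a true) → Dependent U x
    toPivot x (y , y⊑x , y≢0 , Ky≡0) = removeAt y a , removeAt-⊑ a y⊑x , y′≢0 , Uy′≡0
      where
      t = K′ · removeAt y a
      t≡ : ∀ j → t j ≡ y a ∧ K j a
      t≡ j = sym (xor≡false⇒≡ _ _ (trans (sym (·-split K a y j)) (Ky≡0 j)))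
      cancel : ∀ u c → (u ∧ c) xor (c ∧ (u ∧ true)) ≡ false
      cancel true  c = trans (cong (c xor_) (∧-identityʳ c)) (xor-same c)
      cancel false c = ∧-zeroʳ c
      Uy′≡0 : U · removeAt y a ≗ const false
      Uy′≡0 i = trans (U· (removeAt y a) i)
        (trans (cong₂ (λ u v → u xor (K (punchIn j₀ i) a ∧ v)) (t≡ (punchIn j₀ i))
                      (trans (t≡ j₀) (cong (y a ∧_) Kⱼ₀ₐ≡1)))
               (cancel (y a) (K (punchIn j₀ i) a)))
      y′≢0 : Nonzero (removeAt y a)
      y′≢0 with y a in yₐ
      ... | false = Nonzero-removeAt a yₐ y≢0
      ... | true  = Product.map id (∧-conicalˡ _ _)
                      (sum-nonzero (λ e → removeAt y a e ∧ K′ j₀ e)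
                                   (trans (t≡ j₀) (trans (cong (_∧ K j₀ a) yₐ) Kⱼ₀ₐ≡1)))

    -- The value at a is chosen to cancel row j₀; the other rows then vanish because U · y′ does.
    fromPivot : ∀ x → Dependent U x → Dependent K (insertAt x a true)
    fromPivot x (y′ , y′⊑x , y′≢0 , Uy′≡0) =
      insertAt y′ a (t j₀) , insertAt-⊑ a (const refl) y′⊑x , Nonzero-insertAt a (t j₀) y′≢0 ,
      λ j → trans (·-insertAt K a y′ (t j₀) j) (∀-punchIn j₀ at-j₀ at-punchIn j)
      where
      t = K′ · y′
      at-j₀ : (t j₀ ∧ K j₀ a) xor t j₀ ≡ false
      at-j₀ = trans (cong (λ c → (t j₀ ∧ c) xor t j₀) Kⱼ₀ₐ≡1)
                    (trans (cong (_xor t j₀) (∧-identityʳ (t j₀))) (xor-same (t j₀)))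
      at-punchIn : ∀ i → (t j₀ ∧ K (punchIn j₀ i) a) xor t (punchIn j₀ i) ≡ false
      at-punchIn i = trans (trans (xor-comm (t j₀ ∧ K (punchIn j₀ i) a) (t (punchIn j₀ i)))
                                  (cong (t (punchIn j₀ i) xor_) (∧-comm (t j₀) _)))
                           (trans (sym (U· y′ i)) (Uy′≡0 i))

  Independent-contract : ∀ x → Independent K (insertAt x a true) ⇔ Independent (pivot K a j₀) x
  Independent-contract x = ¬-⇔ (mk⇔ (toPivot x) (fromPivot x))

-- Column bases

TrivialKernel-restrict : (A : Matrix₂ r n) {b : Fin k → Fin n} {x : Vector Bool n} →
                         Injective _≡_ _≡_ b → (∀ j → x (b j) ≡ true) → Independent A x →
                         TrivialKernel (restrict A b)
TrivialKernel-restrict A {b} {x} b-inj b⊑x indep c Lc≡0 j = ¬-not λ cⱼ≡1 →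
  indep (push b c ,
         (λ e pushₑ≡1 → let (j′ , bj′≡e) = push-support b-inj c e pushₑ≡1 in
                        subst (λ e → x e ≡ true) bj′≡e (b⊑x j′)) ,
         (b j , trans (push-at b-inj c j) cⱼ≡1) ,
         (λ i → trans (·-push A b c i) (Lc≡0 i)))

InSpan-of-dependency : (A : Matrix₂ r n) {b : Fin k → Fin n} → Injective _≡_ _≡_ b →
                       TrivialKernel (restrict A b) → ∀ e {x : Vector Bool n} →
                       (∀ d → x d ≡ true → d ≡ e ⊎ ∃ λ j → b j ≡ d) → Dependent A x →
                       InSpan (restrict A b) (column A e)
InSpan-of-dependency {n = suc n} A {b} b-inj ker e x⊆b+e (y , y⊑x , y≢0 , Ay≡0) = case-yₑ (y e) refl
  where
  L = restrict A b
  y° = insertAt (removeAt y e) e false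
  supp° : ∀ d → y° d ≡ true → ∃ λ j → b j ≡ d
  supp° = ∀-punchIn e
    (λ y°ₑ≡1 → contradiction (trans (sym (insertAt-lookup (removeAt y e) e false)) y°ₑ≡1) λ ())
    (λ d y°≡1 → [ (λ pe≡e → contradiction pe≡e (punchInᵢ≢i e d)) , id ]′
                  (x⊆b+e (punchIn e d) (y⊑x (punchIn e d) (trans (sym (insertAt-punchIn (removeAt y e) e false d)) y°≡1))))
  Ay≡ : ∀ i → (y e ∧ A i e) xor (L · (y° ∘ b)) i ≡ false
  Ay≡ i = begin
    (y e ∧ A i e) xor (L · (y° ∘ b)) i                     ≡⟨ cong ((y e ∧ A i e) xor_) (sym (·-push A b (y° ∘ b) i)) ⟩
    (y e ∧ A i e) xor (A · push b (y° ∘ b)) i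
      ≡⟨ cong ((y e ∧ A i e) xor_) (sym (·-cong A (push-pull b-inj y° supp°) i)) ⟩
    (y e ∧ A i e) xor (A · y°) i                           ≡⟨ cong ((y e ∧ A i e) xor_) (·-insertAt A e (removeAt y e) false i) ⟩
    (y e ∧ A i e) xor (deleteColumn A e · removeAt y e) i  ≡⟨ sym (·-split A e y i) ⟩
    (A · y) i                                              ≡⟨ Ay≡0 i ⟩
    false                                                  ∎
    where open ≡-Reasoning
  case-yₑ : ∀ v → y e ≡ v → InSpan L (column A e)
  case-yₑ true  yₑ≡1 = y° ∘ b , λ i →
    xor≡false⇒≡ _ _ (trans (cong (λ v → (v ∧ A i e) xor (L · (y° ∘ b)) i) (sym yₑ≡1)) (Ay≡ i))
  case-yₑ false yₑ≡0 =
    let (d , y_d≡1) = y≢0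
        (j , bⱼ≡d) = supp° d (trans (y°≗y d) y_d≡1)
    in contradiction (trans (sym (y°∘b≡0 j)) (trans (cong y° bⱼ≡d) (trans (y°≗y d) y_d≡1))) λ ()
    where
    y°∘b≡0 : y° ∘ b ≗ const false
    y°∘b≡0 = ker (y° ∘ b) λ i → trans (cong (λ v → (v ∧ A i e) xor (L · (y° ∘ b)) i) (sym yₑ≡0)) (Ay≡ i)
    y°≗y : y° ≗ y
    y°≗y = ∀-punchIn e (trans (insertAt-lookup (removeAt y e) e false) (sym yₑ≡0))
                         (insertAt-punchIn (removeAt y e) e false)

record ColumnBasis (A : Matrix₂ r n) (k : ℕ) : Set where
  field
    index       : Fin k → Fin n
    independent : TrivialKernel (restrict A index)
    spanning    : ∀ e → InSpan (restrict A index) (column A e)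

  coefficients : Matrix₂ k n
  coefficients j e = proj₁ (spanning e) j

  factorisation : ∀ i e → A i e ≡ (restrict A index ⋆ coefficients) i e
  factorisation i e = proj₂ (spanning e) i

record Enumeration (k : ℕ) (B : Subset n) : Set where
  field
    index     : Fin k → Fin n
    injective : Injective _≡_ _≡_ index
    index∈    : ∀ j → index j ∈ B
    ∈⇒index   : ∀ {e} → e ∈ B → ∃ λ j → index j ≡ e

columnBasis : (A : Matrix₂ r n) {J : SetSys m} → Iso (LinIndep A) J →
              {B : Subset m} → Basis J B → Enumeration k B → ColumnBasis A k
columnBasis {n = n} {m = m} A {J} (σ , hσ) {B} (J-B , B-maximal) enum = record
  { index       = index
  ; independent = independent
  ; spanning    = spanning
  }
  where
  module E = Enumeration enum
  open Inverse σ using (to; from; strictlyInverseˡ; strictlyInverseʳ)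
  index = from ∘ E.index
  to-injective : Injective _≡_ _≡_ to
  to-injective {d} {e} to-d≡to-e =
    trans (sym (strictlyInverseʳ d)) (trans (cong from to-d≡to-e) (strictlyInverseʳ e))
  index-injective : Injective _≡_ _≡_ index
  index-injective fᵢ≡fⱼ = E.injective (trans (sym (strictlyInverseˡ _)) (trans (cong to fᵢ≡fⱼ) (strictlyInverseˡ _)))
  from-∈⇒index : ∀ {d} → to d ∈ B → ∃ λ j → index j ≡ d
  from-∈⇒index to-d∈B = Product.map id (λ eq → trans (cong from eq) (strictlyInverseʳ _)) (E.∈⇒index to-d∈B)
  pullback : Subset m → Subset n
  pullback Y = tabulate (lookup Y ∘ to)
  image-pullback : ∀ Y → image σ (pullback Y) ≡ Y
  image-pullback Y = trans (tabulate-cong (λ j → trans (lookup∘tabulate (lookup Y ∘ to) (from j))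
                                                       (cong (lookup Y) (strictlyInverseˡ j))))
                           (tabulate∘lookup Y)
  J⇔ : ∀ Y → J Y ⇔ Independent A (lookup Y ∘ to)
  J⇔ Y = ⇔-trans (⇔-trans (mk⇔ (subst J (sym (image-pullback Y))) (subst J (image-pullback Y)))
                          (⇔-sym (hσ (pullback Y))))
                 (⇔-trans (LinIndep⇔Independent A (pullback Y))
                          (Independent-resp-≗ A (lookup∘tabulate (lookup Y ∘ to))))
  independent : TrivialKernel (restrict A index)
  independent = TrivialKernel-restrict A index-injective
    (λ j → trans (cong (lookup B) (strictlyInverseˡ (E.index j))) ([]=⇒lookup (E.index∈ j)))
    (Equivalence.to (J⇔ B) J-B)
  spanning : ∀ e → InSpan (restrict A index) (column A e)
  spanning e with to e ∈? B
  ... | yes toₑ∈B = let (j , indexⱼ≡e) = from-∈⇒index toₑ∈B in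
    δ j , λ i → sym (trans (·-δ (restrict A index) j i) (cong (A i) indexⱼ≡e))
  ... | no toₑ∉B =
    InSpan-of-dependency A index-injective independent e C⊆index+e
      (Dependent-of-¬Independent A (¬J-C ∘ Equivalence.from (J⇔ C)))
    where
    C = B ∪ ⁅ to e ⁆
    ¬J-C : ¬ J C
    ¬J-C J-C = toₑ∉B (B-maximal C (p⊆p∪q ⁅ to e ⁆) J-C (x∈p∪q⁺ (inj₂ (x∈⁅x⁆ (to e)))))
    C⊆index+e : ∀ d → lookup C (to d) ≡ true → d ≡ e ⊎ ∃ λ j → index j ≡ d
    C⊆index+e d C-to-d≡1 =
      [ inj₂ ∘ from-∈⇒index , (λ to-d∈⁅toₑ⁆ → inj₁ (to-injective (x∈⁅y⁆⇒x≡y (to e) to-d∈⁅toₑ⁆))) ]′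
        (x∈p∪q⁻ B ⁅ to e ⁆ (lookup⇒[]= (to d) C C-to-d≡1))

-- Elementary quotients of binary matroids

module _ {I : SetSys (suc n)} (a : Fin (suc n)) where

  Con⇔Del-of-loop : ¬ I ⁅ a ⁆ → ∀ X → Con I a X ⇔ Del I a X
  Con⇔Del-of-loop ¬Iₐ X = mk⇔ [ (λ (Iₐ , _) → contradiction Iₐ ¬Iₐ) , proj₂ ]′ (λ I-X → inj₂ (¬Iₐ , I-X))

  Con⇔-of-nonloop : I ⁅ a ⁆ → ∀ X → Con I a X ⇔ I (Vec.insertAt X a true)
  Con⇔-of-nonloop Iₐ X = mk⇔ [ proj₂ , (λ (¬Iₐ , _) → contradiction Iₐ ¬Iₐ) ]′ (λ I-Xa → inj₁ (Iₐ , I-Xa))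

Con-resp-⇔ : {I J : SetSys (suc n)} (a : Fin (suc n)) → (∀ X → I X ⇔ J X) → ∀ X → Con I a X ⇔ Con J a X
Con-resp-⇔ a I⇔J X = mk⇔
  [ (λ (Iₐ , I-Xa) → inj₁ (to Iₐ , to I-Xa)) , (λ (¬Iₐ , I-X) → inj₂ (¬Iₐ ∘ from , to I-X)) ]′
  [ (λ (Jₐ , J-Xa) → inj₁ (from Jₐ , from J-Xa)) , (λ (¬Jₐ , J-X) → inj₂ (¬Jₐ ∘ to , from J-X)) ]′
  where
  to = λ {Y} → Equivalence.to (I⇔J Y)
  from = λ {Y} → Equivalence.from (I⇔J Y)

module _ (A : Matrix₂ r (suc n)) (a : Fin (suc n)) (basis : ColumnBasis (deleteColumn A a) (suc s)) where

  open ColumnBasis basis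
  private
    A′ = deleteColumn A a
    L  = restrict A′ index

  Independent-coloop : ¬ InSpan L (column A a) → ∀ x →
                       Independent A (insertAt x a false) → Independent A (insertAt x a true)
  Independent-coloop a∉span x indep (y , y⊑x , y≢0 , Ay≡0) with y a in yₐ
  ... | false = indep (Equivalence.from (Dependent-delete A a x) (Dependent-removeAt A a y⊑x yₐ (y≢0 , Ay≡0)))
  ... | true  = a∉span (coefficients · removeAt y a , λ i → trans
                  (xor≡false⇒≡ _ _ (trans (cong (λ u → (u ∧ A i a) xor (A′ · removeAt y a) i) (sym yₐ))
                                          (trans (sym (·-split A a y i)) (Ay≡0 i))))
                  (·-factor L coefficients factorisation (removeAt y a) i))

  module _ {c : Vector Bool (suc s)} (colₐ≡Lc : column A a ≗ L · c) where

    extended : Matrix₂ (suc s) (suc n)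
    extended j = insertAt (coefficients j) a (c j)

    factorisation-extended : ∀ i e → A i e ≡ (L ⋆ extended) i e
    factorisation-extended i = ∀-punchIn a
      (trans (colₐ≡Lc i) (·-cong L (λ j → sym (insertAt-lookup (coefficients j) a (c j))) i))
      (λ e → trans (factorisation i e) (·-cong L (λ j → sym (insertAt-punchIn (coefficients j) a (c j) e)) i))

  quotient : (∀ X → Con (LinIndep A) a X ⇔ Del (LinIndep A) a X)
             ⊎ Σ (Matrix₂ s n) λ U → ∀ X → Con (LinIndep A) a X ⇔ LinIndep U X
  quotient with inSpan? L (column A a)
  ... | no a∉span = inj₁ λ X →
    ⇔-trans (Con⇔-of-nonloop {I = LinIndep A} a (Equivalence.from (LinIndep-⁅⁆⇔nonzero A a)
               (λ colₐ≡0 → a∉span (const false , λ i → trans (colₐ≡0 i) (sym (·-zero L i))))) X)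
    (⇔-trans (LinIndep-insertAt A X a true)
    (⇔-trans (mk⇔ (λ indep → indep ∘ Dependent-mono A (insertAt-⊑ a (const refl) (λ _ → id)))
                  (Independent-coloop a∉span (lookup X)))
             (⇔-sym (LinIndep-insertAt A X a false))))
  ... | yes (c , colₐ≡Lc) with nonzero? c
  ...   | no c≡0 = inj₁ (Con⇔Del-of-loop {I = LinIndep A} a λ indep → Equivalence.to (LinIndep-⁅⁆⇔nonzero A a) indep
                     λ i → trans (colₐ≡Lc i) (trans (·-cong L (λ j → ¬-not (c≡0 ∘ (j ,_))) i) (·-zero L i)))
  ...   | yes (j₀ , cⱼ₀≡1) = inj₂ (pivot K a j₀ , λ X →
    ⇔-trans (Con⇔-of-nonloop {I = LinIndep A} a (Equivalence.from (LinIndep-⁅⁆⇔nonzero A a) colₐ≢0) X)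
    (⇔-trans (LinIndep-insertAt A X a true)
    (⇔-trans (Independent-factor L K (factorisation-extended {c = c} colₐ≡Lc) independent (insertAt (lookup X) a true))
    (⇔-trans (Independent-contract K a j₀ (trans (insertAt-lookup (coefficients j₀) a (c j₀)) cⱼ₀≡1) (lookup X))
             (⇔-sym (LinIndep⇔Independent (pivot K a j₀) X))))))
    where
    K = extended {c = c} colₐ≡Lc
    colₐ≢0 : ¬ column A a ≗ const false
    colₐ≢0 colₐ≡0 =
      contradiction (trans (sym cⱼ₀≡1) (independent c (λ i → trans (sym (colₐ≡Lc i)) (colₐ≡0 i)) j₀)) λ ()

-- Binary matroids of rank at most three

module _ (U : Matrix₂ r n) (F : Matrix₂ r k) {g : Fin k → Fin n} (g-inj : Injective _≡_ _≡_ g)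
         (g-onto : ∀ e → ∃ λ j → g j ≡ e) (U∘g≡F : ∀ i j → U i (g j) ≡ F i j) where

  Dependent-reindex : ∀ x → Dependent U x ⇔ Dependent F (x ∘ g)
  Dependent-reindex x = mk⇔
    (λ (y , y⊑x , (e , yₑ≡1) , Uy≡0) →
       y ∘ g , (λ j → y⊑x (g j)) , Product.map id (λ gⱼ≡e → trans (cong y gⱼ≡e) yₑ≡1) (g-onto e) ,
       λ i → trans (sym (·-congˡ U∘g≡F (y ∘ g) i))
                   (trans (sym (·-push U g (y ∘ g) i))
                          (trans (sym (·-cong U (push-pull g-inj y (λ e _ → g-onto e)) i)) (Uy≡0 i))))
    (λ (z , z⊑x∘g , (j , zⱼ≡1) , Fz≡0) →
       push g z ,
       (λ e pushₑ≡1 → let (j , gⱼ≡e) = push-support g-inj z e pushₑ≡1 in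
                      subst (λ e → x e ≡ true) gⱼ≡e
                        (z⊑x∘g j (trans (sym (push-at g-inj z j)) (subst (λ e → push g z e ≡ true) (sym gⱼ≡e) pushₑ≡1)))) ,
       (g j , trans (push-at g-inj z j) zⱼ≡1) ,
       λ i → trans (·-push U g z i) (trans (·-congˡ U∘g≡F z i) (Fz≡0 i)))

  Iso-reindex : {I : SetSys n} → (∀ X → I X ⇔ LinIndep U X) → Iso I (LinIndep F)
  Iso-reindex I⇔U = σ , λ X →
    ⇔-trans (I⇔U X) (⇔-trans (LinIndep⇔Independent U X)
    (⇔-trans (¬-⇔ (Dependent-reindex (lookup X)))
    (⇔-trans (Independent-resp-≗ F (sym ∘ lookup∘tabulate (lookup X ∘ g)))
             (⇔-sym (LinIndep⇔Independent F (image σ X))))))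
    where
    σ : Fin n ↔ Fin k
    σ = mk↔ₛ′ (proj₁ ∘ g-onto) g (λ j → g-inj (proj₂ (g-onto (g j)))) (proj₂ ∘ g-onto)

-- Columns outside the image of g are deleted one at a time; once g is onto, it is an isomorphism.
HasMinor-restriction : (F : Matrix₂ r k) (U : Matrix₂ r n) {I : SetSys n} → (∀ X → I X ⇔ LinIndep U X) →
                       {g : Fin k → Fin n} → Injective _≡_ _≡_ g → (∀ i j → U i (g j) ≡ F i j) →
                       HasMinor (LinIndep F) I
HasMinor-restriction F U I⇔U {g} g-inj U∘g≡F with any? (λ p → ¬? (any? (λ j → g j ≟ p)))
... | no all-hit = iso (Iso-reindex U F g-inj (λ e → decidable-stable (any? (λ j → g j ≟ e)) (all-hit ∘ (e ,_))) U∘g≡F I⇔U)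
HasMinor-restriction {n = suc n} F U {I} I⇔U {g} g-inj U∘g≡F | yes (p , p∉g) =
  del p (HasMinor-restriction F (deleteColumn U p) Del⇔ g′-inj (λ i j → trans (cong (U i) (punchIn-g′ j)) (U∘g≡F i j)))
  where
  g′ : Fin _ → Fin n
  g′ j = punchOut {i = p} (λ p≡gⱼ → p∉g (j , sym p≡gⱼ))
  punchIn-g′ : ∀ j → punchIn p (g′ j) ≡ g j
  punchIn-g′ j = punchIn-punchOut _
  g′-inj : Injective _≡_ _≡_ g′
  g′-inj g′ᵢ≡g′ⱼ = g-inj (trans (sym (punchIn-g′ _)) (trans (cong (punchIn p) g′ᵢ≡g′ⱼ) (punchIn-g′ _)))
  Del⇔ : ∀ X → Del I p X ⇔ LinIndep (deleteColumn U p) X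
  Del⇔ X = ⇔-trans (I⇔U (Vec.insertAt X p false)) (Del-LinIndep U p X)

shear : Fin r → Vector Bool r → Matrix₂ r r
shear i d k j = δ k j xor (d k ∧ δ i j)

module _ (i : Fin r) (d : Vector Bool r) where

  shear-· : ∀ v k → (shear i d · v) k ≡ v k xor (d k ∧ v i)
  shear-· v k = trans (∑-linear v (δ k) (δ i) (d k)) (cong₂ (λ u w → u xor (d k ∧ w)) (sum-δ v k) (sum-δ v i))

  module _ (dᵢ≡0 : d i ≡ false) where

    shear-fixes-pivot : ∀ v → (shear i d · v) i ≡ v i
    shear-fixes-pivot v = trans (shear-· v i) (trans (cong (λ u → v i xor (u ∧ v i)) dᵢ≡0) (xor-identityʳ (v i)))

    shear-involutive : ∀ v → shear i d · (shear i d · v) ≗ v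
    shear-involutive v k = begin
      (shear i d · (shear i d · v)) k                  ≡⟨ shear-· (shear i d · v) k ⟩
      (shear i d · v) k xor (d k ∧ (shear i d · v) i)  ≡⟨ cong₂ (λ u w → u xor (d k ∧ w)) (shear-· v k) (shear-fixes-pivot v) ⟩
      (v k xor (d k ∧ v i)) xor (d k ∧ v i)            ≡⟨ xor-assoc (v k) _ _ ⟩
      v k xor ((d k ∧ v i) xor (d k ∧ v i))            ≡⟨ cong (v k xor_) (xor-same (d k ∧ v i)) ⟩
      v k xor false                                    ≡⟨ xor-identityʳ (v k) ⟩
      v k                                              ∎
      where open ≡-Reasoning

    TrivialKernel-shear : TrivialKernel (shear i d)
    TrivialKernel-shear c Sc≡0 k = begin
      c k                                              ≡⟨ sym (shear-involutive c k) ⟩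
      (shear i d · (shear i d · c)) k                  ≡⟨ shear-· (shear i d · c) k ⟩
      (shear i d · c) k xor (d k ∧ (shear i d · c) i)  ≡⟨ cong₂ (λ u w → u xor (d k ∧ w)) (Sc≡0 k) (Sc≡0 i) ⟩
      false xor (d k ∧ false)                          ≡⟨ ∧-zeroʳ (d k) ⟩
      false                                            ∎
      where open ≡-Reasoning

shear-all-ones : (i : Fin r) (p : Vector Bool r) → shear i (λ k → p k xor true) · const true ≗ p
shear-all-ones i p k = trans (shear-· i (λ k → p k xor true) (const true) k) (flip-twice (p k))
  where
  flip-twice : ∀ u → true xor ((u xor true) ∧ true) ≡ u
  flip-twice true  = refl
  flip-twice false = refl

-- A column (w₀,w₁,w₂) ≠ (1,1,1) is the incidence vector of this edge of K₄ with vertex 3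
-- dropped (a loop when it is zero); the value at (1,1,1) is junk and never used.
K4-edge : Bool → Bool → Bool → Fin 4 × Fin 4
K4-edge false false false = zero , zero
K4-edge true  false false = zero , suc (suc (suc zero))
K4-edge false true  false = suc zero , suc (suc (suc zero))
K4-edge false false true  = suc (suc zero) , suc (suc (suc zero))
K4-edge true  true  false = zero , suc zero
K4-edge true  false true  = zero , suc (suc zero)
K4-edge false true  true  = suc zero , suc (suc zero)
K4-edge true  true  true  = zero , zero

-- Recovers an incidence vector of K₄ from its first three coordinates; the fourth is their sum.
K4-embedding : Matrix₂ 4 3
K4-embedding zero                   = δ zero
K4-embedding (suc zero)             = δ (suc zero)
K4-embedding (suc (suc zero))       = δ (suc (suc zero))
K4-embedding (suc (suc (suc zero))) = const true

TrivialKernel-K4-embedding : TrivialKernel K4-embedding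
TrivialKernel-K4-embedding c Ec≡0 zero             = trans (sym (sum-δ c zero)) (Ec≡0 zero)
TrivialKernel-K4-embedding c Ec≡0 (suc zero)       = trans (sym (sum-δ c (suc zero))) (Ec≡0 (suc zero))
TrivialKernel-K4-embedding c Ec≡0 (suc (suc zero)) = trans (sym (sum-δ c (suc (suc zero)))) (Ec≡0 (suc (suc zero)))

incidence-K4-edge : ∀ w₀ w₁ w₂ → ¬ (w₀ ≡ true × w₁ ≡ true × w₂ ≡ true) → ∀ k →
                    does (k ≟ proj₁ (K4-edge w₀ w₁ w₂)) xor does (k ≟ proj₂ (K4-edge w₀ w₁ w₂))
                    ≡ (K4-embedding · lookup (w₀ ∷ w₁ ∷ w₂ ∷ [])) k
incidence-K4-edge false false false _    = tabulate-injective refl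
incidence-K4-edge true  false false _    = tabulate-injective refl
incidence-K4-edge false true  false _    = tabulate-injective refl
incidence-K4-edge false false true  _    = tabulate-injective refl
incidence-K4-edge true  true  false _    = tabulate-injective refl
incidence-K4-edge true  false true  _    = tabulate-injective refl
incidence-K4-edge false true  true  _    = tabulate-injective refl
incidence-K4-edge true  true  true  ¬111 = contradiction (refl , refl , refl) ¬111

K4 : Matrix₂ 3 n → Graph n
K4 V = record { nV = 4 ; ends = λ e → K4-edge (V zero e) (V (suc zero) e) (V (suc (suc zero)) e) }

incidence-K4 : (V : Matrix₂ 3 n) → (∀ e → ¬ column V e ≗ const true) →
               ∀ k e → incidence (K4 V) k e ≡ (K4-embedding ⋆ V) k e
incidence-K4 V ¬111 k e = trans
  (incidence-K4-edge (V zero e) (V (suc zero) e) (V (suc (suc zero)) e)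
     (λ (v₀ , v₁ , v₂) → ¬111 e λ { zero → v₀ ; (suc zero) → v₁ ; (suc (suc zero)) → v₂ }) k)
  (·-cong K4-embedding {y = lookup (V zero e ∷ V (suc zero) e ∷ V (suc (suc zero)) e ∷ [])} {y′ = column V e}
     (λ { zero → refl ; (suc zero) → refl ; (suc (suc zero)) → refl }) k)

Graphic-of-missing-point : (U : Matrix₂ 3 n) (p : Vector Bool 3) → Nonzero p →
                           (∀ e → ¬ column U e ≗ p) → Graphic (LinIndep U)
Graphic-of-missing-point U p (i , pᵢ≡1) missing = K4 V , λ X →
  ⇔-trans (LinIndep⇔Independent U X)
  (⇔-trans (⇔-sym (Independent-factor S U (λ _ _ → refl) (TrivialKernel-shear i d dᵢ≡0) (lookup X)))
  (⇔-trans (⇔-sym (Independent-factor K4-embedding V (incidence-K4 V V-avoids-111) TrivialKernel-K4-embedding (lookup X)))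
           (⇔-sym (LinIndep⇔Independent (incidence (K4 V)) X))))
  where
  d : Vector Bool 3
  d k = p k xor true
  dᵢ≡0 : d i ≡ false
  dᵢ≡0 = cong (_xor true) pᵢ≡1
  S = shear i d
  V = S ⋆ U
  V-avoids-111 : ∀ e → ¬ column V e ≗ const true
  V-avoids-111 e Sₑ≡1 = missing e λ k → begin
    U k e                     ≡⟨ sym (shear-involutive i d dᵢ≡0 (column U e) k) ⟩
    (S · (S · column U e)) k  ≡⟨ ·-cong S Sₑ≡1 k ⟩
    (S · const true) k        ≡⟨ shear-all-ones i p k ⟩
    p k                       ∎
    where open ≡-Reasoning

fano-columns-distinct : ∀ p q → (∀ i → fanoMatrix i p ≡ fanoMatrix i q) → p ≡ q
fano-columns-distinct = from-yes (all? λ p → all? λ q → all? (λ i → fanoMatrix i p Bool.≟ fanoMatrix i q) →-dec (p ≟ q))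

fano-columns-nonzero : ∀ p → Nonzero (column fanoMatrix p)
fano-columns-nonzero = from-yes (all? λ p → nonzero? (column fanoMatrix p))

Graphic-or-HasMinor-F7 : (U : Matrix₂ 3 n) {I : SetSys n} → (∀ X → I X ⇔ LinIndep U X) → Graphic I ⊎ HasMinor F7 I
Graphic-or-HasMinor-F7 {n = n} U I⇔U with all? (λ p → any? (λ e → all? (λ i → U i e Bool.≟ fanoMatrix i p)))
... | yes all-present = inj₂ (HasMinor-restriction fanoMatrix U I⇔U g-inj (λ i p → proj₂ (all-present p) i))
  where
  g : Fin 7 → Fin n
  g p = proj₁ (all-present p)
  g-inj : Injective _≡_ _≡_ g
  g-inj {p} {q} gₚ≡g_q = fano-columns-distinct p q λ i →
    trans (sym (proj₂ (all-present p) i)) (trans (cong (U i) gₚ≡g_q) (proj₂ (all-present q) i))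
... | no ¬all-present =
  let (p , p-missing) = ¬∀⟶∃¬ 7 _ (λ p → any? (λ e → all? (λ i → U i e Bool.≟ fanoMatrix i p))) ¬all-present
      (G , U⇔G) = Graphic-of-missing-point U (column fanoMatrix p) (fano-columns-nonzero p) (λ e → p-missing ∘ (e ,_))
  in inj₁ (G , λ X → ⇔-trans (I⇔U X) (U⇔G X))

-- The cotree of K₃,₃ as a basis of M*(K₃,₃)

Basis-∁ : {I : SetSys n} {T : Subset n} → Basis I T → Basis (Dual I) (∁ T)
Basis-∁ {I = I} {T} T-basis@(I-T , _) = (T , T-basis , λ e e∈∁T e∈T → x∈∁p⇒x∉p e∈∁T e∈T) , ∁T-maximal
  where
  ∁T-maximal : ∀ C → ∁ T ⊆ C → Dual I C → C ⊆ ∁ T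
  ∁T-maximal C ∁T⊆C (B , (_ , B-maximal) , C∩B≡∅) {x} x∈C = x∉p⇒x∈∁p λ x∈T → C∩B≡∅ x x∈C (T⊆B x∈T)
    where
    B⊆T : B ⊆ T
    B⊆T {y} y∈B = decidable-stable (y ∈? T) λ y∉T → C∩B≡∅ y (∁T⊆C (x∉p⇒x∈∁p y∉T)) y∈B
    T⊆B : T ⊆ B
    T⊆B = B-maximal T B⊆T I-T

-- The star at vertex 0 together with the edges 1–3 and 2–3.
spanningTree : Subset 9
spanningTree = true ∷ true ∷ true ∷ true ∷ false ∷ false ∷ true ∷ false ∷ false ∷ []

spanningTree-basis : Basis (CycleMatroid K33) spanningTree
spanningTree-basis = independent , maximal
  where
  T = spanningTree
  independent : CycleMatroid K33 T
  independent = Equivalence.from (LinIndep⇔Independent (incidence K33) T)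
                                 (from-no (dependent? (incidence K33) (lookup T)))
  fundamental-cycle : ∀ x → x ∉ T → Dependent (incidence K33) (lookup (T ∪ ⁅ x ⁆))
  fundamental-cycle = from-yes (all? λ x → ¬? (x ∈? T) →-dec dependent? (incidence K33) (lookup (T ∪ ⁅ x ⁆)))
  maximal : ∀ C → T ⊆ C → CycleMatroid K33 C → C ⊆ T
  maximal C T⊆C C-indep {x} x∈C = decidable-stable (x ∈? T) λ x∉T →
    Equivalence.to (LinIndep⇔Independent (incidence K33) (T ∪ ⁅ x ⁆))
      (λ Y Y⊆T+x → C-indep Y (λ y∈Y → T+x⊆C (Y⊆T+x y∈Y)))
      (fundamental-cycle x x∉T)
    where
    T+x⊆C : T ∪ ⁅ x ⁆ ⊆ C
    T+x⊆C e∈T+x = [ T⊆C , (λ e∈⁅x⁆ → subst (_∈ C) (sym (x∈⁅y⁆⇒x≡y x e∈⁅x⁆)) x∈C) ]′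
                    (x∈p∪q⁻ T ⁅ x ⁆ e∈T+x)

cotree-enumeration : Enumeration 4 (∁ spanningTree)
cotree-enumeration = record
  { index     = index
  ; injective = λ {j} {j′} → from-yes (all? λ j → all? λ j′ → (index j ≟ index j′) →-dec (j ≟ j′)) j j′
  ; index∈    = from-yes (all? λ j → index j ∈? ∁ spanningTree)
  ; ∈⇒index   = λ {e} → from-yes (all? λ e → (e ∈? ∁ spanningTree) →-dec any? (λ j → index j ≟ e)) e
  }
  where
  index : Fin 4 → Fin 9
  index = lookup (# 4 ∷ # 5 ∷ # 7 ∷ # 8 ∷ [])

lemma2p15 : ∀ {m : ℕ} (N : SetSys (suc m)) (a : Fin (suc m)) →
            IsMatroid N → Binary N →
            Iso (Del N a) MK33dual →
            ¬ Graphic (Con N a) →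
            ¬ HasMinor F7 (Con N a) →
            ¬ HasMinor F7dual (Con N a) →
            Iso (Con N a) MK33dual
lemma2p15 N a _ (r , A , N⇔A) (σ , N\a≅MK33*) ¬graphic ¬F7 _ =
  [ (λ Con⇔Del → σ , λ X → ⇔-trans (Con-resp-⇔ a N⇔A X) (⇔-trans (Con⇔Del X)
                            (⇔-trans (⇔-sym (N⇔A (Vec.insertAt X a false))) (N\a≅MK33* X))))
  , (λ (U , Con⇔U) → ⊥-elim ([ ¬graphic , ¬F7 ]′
                       (Graphic-or-HasMinor-F7 U λ X → ⇔-trans (Con-resp-⇔ a N⇔A X) (Con⇔U X))))
  ]′ (quotient A a basis)
  where
  N\a⇔A′ : ∀ X → Del N a X ⇔ LinIndep (deleteColumn A a) X
  N\a⇔A′ X = ⇔-trans (N⇔A (Vec.insertAt X a false)) (Del-LinIndep A a X)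
  basis : ColumnBasis (deleteColumn A a) 4
  basis = columnBasis (deleteColumn A a) (σ , λ X → ⇔-trans (⇔-sym (N\a⇔A′ X)) (N\a≅MK33* X))
                      (Basis-∁ spanningTree-basis) cotree-enumeration
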